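{- Let $\mathbf{x}=x_1x_2\ldots x_n$ be a restricted ascent sequence, let $x_i$ be the last repetition of the rightmost maximal letter of $\mathbf{x}$, and let $\mathbf{x}'=x_{i+1}x_{i+2}\ldots x_n$. If $\mathbf{x}'$ is nonempty, then $x_{i+1}=x_i-1$, and the sequence obtained by subtracting $x_{i+1}$ from each letter of $\mathbf{x}'$ is a restricted ascent sequence.
   Context: An ascent sequence is a finite sequence $x_1x_2\ldots x_n$ of nonnegative integers with $x_1=0$ and $x_i\le \operatorname{asc}(x_1\ldots x_{i-1})+1$ for all $1<i\le n$, where $\operatorname{asc}(y_1\ldots y_k)$ is the number of indices $j$ with $y_j<y_{j+1}$. A restricted ascent sequence is an ascent sequence with $x_i\ge m_i-1$ for all $2\le i\le n$, where $m_i=\max(x_1,\ldots,x_{i-1})$. A letter $x_j$ of an ascent sequence is maximal if $x_j=\operatorname{asc}(x_1\ldots x_{j-1})+1$; additionally, the initial letter $x_1=0$ is defined to be maximal. The rightmost maximal letter is the maximal letter $x_j$ with largest index $j$. If $x_j$ is maximal and $x_j=x_{j+1}=\cdots=x_{j+k}$ with $k\ge1$ and either $j+k=n$ or $x_{j+k+1}\ne x_j$, then $x_j$ is called a repeated maximal letter and $x_{j+k}$ is its last repetition; a maximal letter that is not repeated is its own last repetition. -}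

module Defs where

open import Data.Nat using (ℕ; zero; suc; _+_; _∸_; _≤_; _<ᵇ_; _⊔_)
open import Data.Bool using (if_then_else_)
open import Data.List using (List; []; _∷_; _++_; length; foldr; replicate)
open import Data.Product using (Σ; ∃; _×_; _,_)
open import Data.Sum using (_⊎_)
open import Relation.Binary.PropositionalEquality using (_≡_; _≢_)

-- Sequences x₁x₂…xₙ are lists of naturals; positions are 0-indexed list
-- positions (the letter at position j is the (j+1)-th letter).

asc : List ℕ → ℕ
asc []            = 0
asc (x ∷ [])      = 0
asc (x ∷ y ∷ r)   = (if x <ᵇ y then 1 else 0) + asc (y ∷ r)

-- maximum of a list (only used on nonempty prefixes)
maxL : List ℕ → ℕ
maxL = foldr _⊔_ 0

IsAscentSeq : List ℕ → Set
IsAscentSeq xs =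
  (∃ λ r → xs ≡ 0 ∷ r) ×
  (∀ p y s → xs ≡ p ++ y ∷ s → p ≢ [] → y ≤ suc (asc p))

IsRestrictedAscentSeq : List ℕ → Set
IsRestrictedAscentSeq xs =
  IsAscentSeq xs ×
  (∀ p y s → xs ≡ p ++ y ∷ s → p ≢ [] → maxL p ∸ 1 ≤ y)

-- the letter y preceded by prefix p is maximal (initial letter always maximal)
MaximalLetter : List ℕ → ℕ → Set
MaximalLetter p y = p ≡ [] ⊎ y ≡ suc (asc p)

MaximalAt : List ℕ → ℕ → Set
MaximalAt xs j = Σ (List ℕ) λ p → Σ ℕ λ y → Σ (List ℕ) λ s →
  xs ≡ p ++ y ∷ s × length p ≡ j × MaximalLetter p y

RightmostMaximalAt : List ℕ → ℕ → Set
RightmostMaximalAt xs j = MaximalAt xs j × (∀ j' → MaximalAt xs j' → j' ≤ j)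

-- xs = p ++ a ∷ (a repeated k times) ++ x', where a (at position length p)
-- is the rightmost maximal letter, and the last copy of a in the displayed
-- run is its last repetition (x' is empty or does not start with a);
-- thus x' is the suffix after the last repetition.
LastRepSplit : List ℕ → List ℕ → ℕ → ℕ → List ℕ → Set
LastRepSplit xs p a k x' =
  xs ≡ p ++ a ∷ (replicate k a ++ x') ×
  RightmostMaximalAt xs (length p) ×
  (x' ≡ [] ⊎ Σ ℕ λ b → Σ (List ℕ) λ t → x' ≡ b ∷ t × b ≢ a)

module Submission where

-- Lemma 2.14.  Write xs = p · a · aᵏ · b · t, where a (preceded by p) is the
-- rightmost maximal letter, a · aᵏ its run of repetitions and x' = b · t.
-- Three facts about the ascent sequence xs carry the proof:
--   (1) every prefix P satisfies max P ≤ asc P; hence a maximal letter a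
--       always creates an ascent, and asc (p · a) = a;
--   (2) repeating a letter creates no ascent, so the prefix p · a · aᵏ · q
--       has a + asc (a · q) ascents;
--   (3) no letter after the rightmost maximal one is maximal, so each such
--       letter y is at most asc of its prefix.
-- By (2) and (3) with q empty, b ≤ a; b ≠ a since a · aᵏ is the whole run;
-- the restriction gives b ≥ a - 1, so b = a - 1.  The restriction also
-- bounds every letter of x' below by a - 1 = b, so subtracting b preserves
-- ascents and shifts maxima by b; then (2), (3) (with a · b not an ascent)
-- turn into the ascent and restriction conditions for the shifted x'.

open import Defs
open import Data.Nat using (ℕ; zero; suc; _+_; _∸_; _≤_; _<_; _<ᵇ_; _⊔_; z≤n; s≤s)
open import Data.Nat.Properties
open import Data.Bool using (if_then_else_)
open import Data.List using (List; []; _∷_; _++_; _∷ʳ_; [_]; map; length; replicate)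
open import Data.List.Properties using (++-assoc; ++-conicalʳ; ∷-injectiveˡ; ∷-injectiveʳ; length-++)
open import Data.List.Reverse using (Reverse; []; _∶_∶ʳ_; reverseView)
open import Data.List.Relation.Unary.All using (All; []; _∷_)
open import Data.List.Relation.Unary.All.Properties using (++⁻ˡ)
open import Data.Product using (Σ; _×_; _,_; proj₂)
open import Data.Sum using (_⊎_; inj₁; inj₂)
open import Data.Empty using (⊥-elim)
open import Relation.Nullary using (yes; no)
open import Relation.Binary.PropositionalEquality
  using (_≡_; _≢_; refl; sym; trans; cong; cong₂; subst; module ≡-Reasoning)

ascentBit : ℕ → ℕ → ℕ
ascentBit x y = if x <ᵇ y then 1 else 0

ascentBit-< : ∀ {x y} → x < y → ascentBit x y ≡ 1
ascentBit-< {zero}  {suc y} _         = refl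
ascentBit-< {suc x} {suc y} (s≤s x<y) = ascentBit-< x<y

ascentBit-≥ : ∀ {x y} → y ≤ x → ascentBit x y ≡ 0
ascentBit-≥ {zero}  {zero}  _         = refl
ascentBit-≥ {suc x} {zero}  _         = refl
ascentBit-≥ {suc x} {suc y} (s≤s y≤x) = ascentBit-≥ y≤x

ascentBit-∸ : ∀ b {x y} → b ≤ x → b ≤ y → ascentBit (x ∸ b) (y ∸ b) ≡ ascentBit x y
ascentBit-∸ zero    _       _       = refl
ascentBit-∸ (suc b) (s≤s p) (s≤s q) = ascentBit-∸ b p q

squeeze : ∀ {a b} → b < a → a ∸ 1 ≤ b → a ≡ suc b
squeeze {suc a} (s≤s b≤a) a≤b = cong suc (≤-antisym a≤b b≤a)

∸-swap : ∀ m b → m ∸ b ∸ 1 ≡ m ∸ 1 ∸ b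
∸-swap m b = begin
  m ∸ b ∸ 1    ≡⟨ ∸-+-assoc m b 1 ⟩
  m ∸ (b + 1)  ≡⟨ cong (m ∸_) (+-comm b 1) ⟩
  m ∸ (1 + b)  ≡⟨ sym (∸-+-assoc m 1 b) ⟩
  m ∸ 1 ∸ b    ∎
  where open ≡-Reasoning

asc-∷ʳ-ascent : ∀ v a → v ≢ [] → maxL v < a → asc (v ∷ʳ a) ≡ suc (asc v)
asc-∷ʳ-ascent []          a v≢[] _  = ⊥-elim (v≢[] refl)
asc-∷ʳ-ascent (x ∷ [])    a _    lt = cong (_+ 0) (ascentBit-< (≤-<-trans (m≤m⊔n x 0) lt))
asc-∷ʳ-ascent (x ∷ y ∷ v) a _    lt =
  trans (cong (ascentBit x y +_) (asc-∷ʳ-ascent (y ∷ v) a (λ ()) (≤-<-trans (m≤n⊔m x _) lt)))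
        (+-suc (ascentBit x y) _)

asc-∷ʳ-mono : ∀ v a → asc v ≤ asc (v ∷ʳ a)
asc-∷ʳ-mono []          a = z≤n
asc-∷ʳ-mono (x ∷ [])    a = z≤n
asc-∷ʳ-mono (x ∷ y ∷ v) a = +-monoʳ-≤ (ascentBit x y) (asc-∷ʳ-mono (y ∷ v) a)

asc-split : ∀ u y w → asc (u ++ y ∷ w) ≡ asc (u ∷ʳ y) + asc (y ∷ w)
asc-split []           y w = refl
asc-split (x ∷ [])     y w = cong (_+ asc (y ∷ w)) (sym (+-identityʳ (ascentBit x y)))
asc-split (x ∷ x' ∷ u) y w =
  trans (cong (ascentBit x x' +_) (asc-split (x' ∷ u) y w)) (sym (+-assoc (ascentBit x x') _ _))

asc-plateau : ∀ a k w → asc (a ∷ (replicate k a ++ w)) ≡ asc (a ∷ w)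
asc-plateau a zero    w = refl
asc-plateau a (suc k) w =
  trans (cong (_+ asc (a ∷ (replicate k a ++ w))) (ascentBit-≥ (≤-refl {a}))) (asc-plateau a k w)

asc-shift : ∀ b l → All (b ≤_) l → asc (map (_∸ b) l) ≡ asc l
asc-shift b []          _                 = refl
asc-shift b (x ∷ [])    _                 = refl
asc-shift b (x ∷ y ∷ l) (b≤x ∷ b≤y ∷ b≤l) =
  cong₂ _+_ (ascentBit-∸ b b≤x b≤y) (asc-shift b (y ∷ l) (b≤y ∷ b≤l))

maxL-++ : ∀ u v → maxL (u ++ v) ≡ maxL u ⊔ maxL v
maxL-++ []      v = refl
maxL-++ (x ∷ u) v = trans (cong (x ⊔_) (maxL-++ u v)) (sym (⊔-assoc x (maxL u) (maxL v)))

maxL-suffix : ∀ u v → maxL v ≤ maxL (u ++ v)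
maxL-suffix u v = subst (maxL v ≤_) (sym (maxL-++ u v)) (m≤n⊔m (maxL u) (maxL v))

maxL-shift : ∀ b l → maxL (map (_∸ b) l) ≡ maxL l ∸ b
maxL-shift b []      = sym (0∸n≡0 b)
maxL-shift b (x ∷ l) = trans (cong ((x ∸ b) ⊔_) (maxL-shift b l)) (sym (∸-distribʳ-⊔ b x (maxL l)))

split-unique : ∀ {A : Set} (p p′ : List A) {y y′ s s′} →
  p ++ y ∷ s ≡ p′ ++ y′ ∷ s′ → length p ≡ length p′ → p ≡ p′ × y ≡ y′
split-unique []      []        e _   = refl , ∷-injectiveˡ e
split-unique (x ∷ p) (x' ∷ p′) e len with split-unique p p′ (∷-injectiveʳ e) (suc-injective len)
... | refl , refl = cong (_∷ p) (∷-injectiveˡ e) , refl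

map-split : ∀ {A B : Set} (f : A → B) l {q y s} → map f l ≡ q ++ y ∷ s →
  Σ (List A) λ q₀ → Σ A λ y₀ → Σ (List A) λ s₀ →
    l ≡ q₀ ++ y₀ ∷ s₀ × map f q₀ ≡ q × f y₀ ≡ y
map-split f []      {[]}    ()
map-split f []      {_ ∷ _} ()
map-split f (x ∷ l) {[]}    e = [] , x , l , refl , refl , ∷-injectiveˡ e
map-split f (x ∷ l) {_ ∷ q} e with map-split f l (∷-injectiveʳ e)
... | q₀ , y₀ , s₀ , l≡ , refl , fy₀≡ =
  x ∷ q₀ , y₀ , s₀ , cong (x ∷_) l≡ , cong (_∷ map f q₀) (∷-injectiveˡ e) , fy₀≡

All-fromSplits : ∀ {A : Set} {P : A → Set} l → (∀ q y s → l ≡ q ++ y ∷ s → P y) → All P l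
All-fromSplits []      _ = []
All-fromSplits (x ∷ l) h = h [] x l refl ∷ All-fromSplits l (λ q y s e → h (x ∷ q) y s (cong (x ∷_) e))

maximalAt-letter : ∀ {xs p a w} → xs ≡ p ++ a ∷ w → MaximalAt xs (length p) → MaximalLetter p a
maximalAt-letter {p = p} xs≡ (p′ , y , s , xs≡′ , len , maximal)
  with split-unique p′ p (trans (sym xs≡′) xs≡) len
... | refl , refl = maximal

next-letter-≢ : ∀ {x' a b t} →
  (x' ≡ [] ⊎ Σ ℕ λ b′ → Σ (List ℕ) λ t′ → x' ≡ b′ ∷ t′ × b′ ≢ a) → x' ≡ b ∷ t → b ≢ a
next-letter-≢ (inj₁ refl)                 ()
next-letter-≢ (inj₂ (_ , _ , refl , b≢a)) refl = b≢a

max≤asc-∷ʳ : ∀ v y → v ≢ [] → maxL v ≤ asc v → y ≤ suc (asc v) → maxL (v ∷ʳ y) ≤ asc (v ∷ʳ y)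
max≤asc-∷ʳ v y v≢[] max≤asc y≤ =
  subst (_≤ asc (v ∷ʳ y)) (sym (trans (maxL-++ v [ y ]) (cong (maxL v ⊔_) (⊔-identityʳ y)))) bound
  where
  bound : maxL v ⊔ y ≤ asc (v ∷ʳ y)
  bound with y ≤? asc v
  ... | yes y≤asc = ≤-trans (⊔-lub max≤asc y≤asc) (asc-∷ʳ-mono v y)
  ... | no  y≰asc =
    subst (maxL v ⊔ y ≤_) (sym (asc-∷ʳ-ascent v y v≢[] (≤-<-trans max≤asc (≰⇒> y≰asc))))
      (⊔-lub (m≤n⇒m≤1+n max≤asc) y≤)

max≤asc : ∀ {xs} → IsAscentSeq xs → ∀ P {s} → xs ≡ P ++ s → maxL P ≤ asc P
max≤asc {xs} ((_ , xs≡0∷r) , bounded) P = go (reverseView P)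
  where
  go : ∀ {P s} → Reverse P → xs ≡ P ++ s → maxL P ≤ asc P
  go []                   _   = z≤n
  go ([] ∶ _ ∶ʳ y)        xs≡ = ≤-reflexive (cong (_⊔ 0) (sym (∷-injectiveˡ (trans (sym xs≡0∷r) xs≡))))
  go {s = s} (v@(_ ∷ _) ∶ rv ∶ʳ y) xs≡ =
    max≤asc-∷ʳ v y (λ ()) (go rv xs≡′) (bounded v y s xs≡′ (λ ()))
    where
    xs≡′ : xs ≡ v ++ y ∷ s
    xs≡′ = trans xs≡ (++-assoc v [ y ] s)

asc-at-maximal : ∀ {xs} → IsAscentSeq xs → ∀ p {a w} → xs ≡ p ++ a ∷ w →
  MaximalLetter p a → asc (p ∷ʳ a) ≡ a
asc-at-maximal ((_ , xs≡0∷r) , _) [] xs≡ _ = ∷-injectiveˡ (trans (sym xs≡0∷r) xs≡)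
asc-at-maximal _ (_ ∷ _) _ (inj₁ ())
asc-at-maximal seq p@(_ ∷ _) xs≡ (inj₂ a≡) =
  trans (asc-∷ʳ-ascent p _ (λ ()) (subst (maxL p <_) (sym a≡) (s≤s (max≤asc seq p xs≡)))) (sym a≡)

module AfterLastRepetition
  (xs p t : List ℕ) (a k b : ℕ)
  (ascent : IsAscentSeq xs)
  (restricted : ∀ q y s → xs ≡ q ++ y ∷ s → q ≢ [] → maxL q ∸ 1 ≤ y)
  (xs≡ : xs ≡ p ++ a ∷ (replicate k a ++ b ∷ t))
  (a-maximal : MaximalLetter p a)
  (rightmost : ∀ j → MaximalAt xs j → j ≤ length p)
  (b≢a : b ≢ a)
  where

  R : List ℕ
  R = replicate k a

  before : List ℕ → List ℕ
  before q = p ++ a ∷ (R ++ q)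

  before-nonempty : ∀ q → before q ≢ []
  before-nonempty q e with ++-conicalʳ p (a ∷ (R ++ q)) e
  ... | ()

  split-xs : ∀ {q y s} → b ∷ t ≡ q ++ y ∷ s → xs ≡ before q ++ y ∷ s
  split-xs {q} {y} {s} e = begin
    xs                              ≡⟨ xs≡ ⟩
    p ++ a ∷ (R ++ b ∷ t)           ≡⟨ cong (λ w → p ++ a ∷ (R ++ w)) e ⟩
    p ++ a ∷ (R ++ q ++ y ∷ s)      ≡⟨ cong (λ w → p ++ a ∷ w) (sym (++-assoc R q (y ∷ s))) ⟩
    p ++ (a ∷ (R ++ q)) ++ y ∷ s    ≡⟨ sym (++-assoc p (a ∷ (R ++ q)) (y ∷ s)) ⟩
    before q ++ y ∷ s               ∎
    where open ≡-Reasoning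

  asc-before : ∀ q → asc (before q) ≡ a + asc (a ∷ q)
  asc-before q = begin
    asc (p ++ a ∷ (R ++ q))            ≡⟨ asc-split p a (R ++ q) ⟩
    asc (p ∷ʳ a) + asc (a ∷ (R ++ q))  ≡⟨ cong₂ _+_ (asc-at-maximal ascent p xs≡ a-maximal) (asc-plateau a k q) ⟩
    a + asc (a ∷ q)                    ∎
    where open ≡-Reasoning

  a≤max-before : ∀ q → a ≤ maxL (before q)
  a≤max-before q = ≤-trans (m≤m⊔n a _) (maxL-suffix p (a ∷ (R ++ q)))

  max-≤-before : ∀ q → maxL q ≤ maxL (before q)
  max-≤-before q = ≤-trans (maxL-suffix (a ∷ R) q) (maxL-suffix p (a ∷ (R ++ q)))

  not-maximal : ∀ {q y s} → xs ≡ before q ++ y ∷ s → y ≤ asc (before q)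
  not-maximal {q} {y} {s} e =
    ≤-pred (≤∧≢⇒< (proj₂ ascent (before q) y s e (before-nonempty q)) y-not-maximal)
    where
    y-not-maximal : y ≢ suc (asc (before q))
    y-not-maximal y≡ = m+1+n≰m (length p)
      (subst (_≤ length p) (length-++ p) (rightmost _ (before q , y , s , e , refl , inj₂ y≡)))

  -- Every letter y of x' is at least max (before q) - 1 ≥ a - 1.
  restricted-x' : ∀ {q y s} → b ∷ t ≡ q ++ y ∷ s → a ∸ 1 ≤ y
  restricted-x' {q} {y} {s} e =
    ≤-trans (∸-monoˡ-≤ 1 (a≤max-before q)) (restricted _ y s (split-xs e) (before-nonempty q))

  -- b is not maximal, so b ≤ a by (2) and (3); and b ≠ a.
  b<a : b < a
  b<a = ≤∧≢⇒< (subst (b ≤_) (trans (asc-before []) (+-identityʳ a)) (not-maximal (split-xs {q = []} refl))) b≢a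

  -- Together with b ≥ a - 1 from the restriction: b = a - 1.
  a≡1+b : a ≡ suc b
  a≡1+b = squeeze b<a (restricted-x' {q = []} refl)

  b≤x' : All (b ≤_) (b ∷ t)
  b≤x' = All-fromSplits (b ∷ t) λ q y s e → subst (_≤ y) (cong (_∸ 1) a≡1+b) (restricted-x' e)

  shift-ascent : ∀ q y s → map (_∸ b) (b ∷ t) ≡ q ++ y ∷ s → q ≢ [] → y ≤ suc (asc q)
  shift-ascent q y s e q≢[] with map-split (_∸ b) (b ∷ t) e
  ... | [] , _ , _ , _ , refl , _ = ⊥-elim (q≢[] refl)
  ... | c ∷ q₀ , y₀ , s₀ , e₀ , refl , refl with ∷-injectiveˡ e₀
  ... | refl = m≤n+o⇒m∸n≤o y₀ b (subst (y₀ ≤_) ascents (not-maximal (split-xs e₀)))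
    where
    b≤b∷q₀ : All (b ≤_) (b ∷ q₀)
    b≤b∷q₀ = ++⁻ˡ (b ∷ q₀) (subst (All (b ≤_)) e₀ b≤x')
    ascents : asc (before (b ∷ q₀)) ≡ b + suc (asc (map (_∸ b) (b ∷ q₀)))
    ascents = begin
      asc (before (b ∷ q₀))                ≡⟨ asc-before (b ∷ q₀) ⟩
      a + (ascentBit a b + asc (b ∷ q₀))   ≡⟨ cong₂ (λ u v → u + (v + asc (b ∷ q₀))) a≡1+b (ascentBit-≥ (<⇒≤ b<a)) ⟩
      suc (b + asc (b ∷ q₀))               ≡⟨ sym (+-suc b _) ⟩
      b + suc (asc (b ∷ q₀))               ≡⟨ cong (λ n → b + suc n) (sym (asc-shift b (b ∷ q₀) b≤b∷q₀)) ⟩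
      b + suc (asc (map (_∸ b) (b ∷ q₀)))  ∎
      where open ≡-Reasoning

  shift-restricted : ∀ q y s → map (_∸ b) (b ∷ t) ≡ q ++ y ∷ s → q ≢ [] → maxL q ∸ 1 ≤ y
  shift-restricted q y s e _ with map-split (_∸ b) (b ∷ t) e
  ... | q₀ , y₀ , s₀ , e₀ , refl , refl = begin
    maxL (map (_∸ b) q₀) ∸ 1   ≡⟨ cong (_∸ 1) (maxL-shift b q₀) ⟩
    maxL q₀ ∸ b ∸ 1            ≡⟨ ∸-swap (maxL q₀) b ⟩
    maxL q₀ ∸ 1 ∸ b            ≤⟨ ∸-monoˡ-≤ b (∸-monoˡ-≤ 1 (max-≤-before q₀)) ⟩
    maxL (before q₀) ∸ 1 ∸ b   ≤⟨ ∸-monoˡ-≤ b (restricted _ y₀ s₀ (split-xs e₀) (before-nonempty q₀)) ⟩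
    y₀ ∸ b                     ∎
    where open ≤-Reasoning

  shifted-restricted : IsRestrictedAscentSeq (map (_∸ b) (b ∷ t))
  shifted-restricted = ((map (_∸ b) t , cong (_∷ map (_∸ b) t) (n∸n≡0 b)) , shift-ascent) , shift-restricted

lemma2p14 : ∀ (xs p x' : List ℕ) (a k : ℕ) →
    IsRestrictedAscentSeq xs → LastRepSplit xs p a k x' →
    ∀ (b : ℕ) (t : List ℕ) → x' ≡ b ∷ t →
    (b + 1 ≡ a) × All (λ y → b ≤ y) x' × IsRestrictedAscentSeq (map (λ y → y ∸ b) x')
lemma2p14 xs p x' a k (ascent , restricted) (xs≡ , (maximal-at , rightmost) , x'-shape) b t refl =
  trans (+-comm b 1) (sym a≡1+b) , b≤x' , shifted-restricted
  where
  open AfterLastRepetition xs p t a k b ascent restricted xs≡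
    (maximalAt-letter xs≡ maximal-at) rightmost (next-letter-≢ x'-shape refl)
    using (a≡1+b; b≤x'; shifted-restricted)
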